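{- Consider a signature with a base type $\mathtt{nat}$ and constants $\mathtt z:\mathtt{nat}$, $\mathtt s:\mathtt{nat}\to\mathtt{nat}$, a fixed-point predicate $\mathtt{ev}:\mathtt{nat}\to o$ and an inductive predicate $\mathtt{odd}:\mathtt{nat}\to o$, and the definition $\mathcal D$ consisting of the clauses $\mathrm{eq}\,X\,X\stackrel{\Delta}{=}_X\top$, $\mathtt{ev}\,\mathtt z\stackrel{\Delta}{=}\top$, $\mathtt{ev}\,(\mathtt s\,X)\stackrel{\Delta}{=}_X(\mathtt{ev}\,X\supset\bot)$, and the single inductive clause $\mathtt{odd}\,(\mathtt s\,X)\stackrel{\mu}{=}_X(\mathtt{odd}\,X\supset\bot)$. Then $\mathcal D$ is ground stratified (under a level assignment in which the level of $\mathtt{odd}\,t$ depends on $t$), and the sequent $\emptyset;\cdot\vdash\bot$ is derivable using the rules of $\text{LD}^{\mu}$ with this definition. Consequently, relaxing the requirement on inductive predicates in $\text{LD}^{\mu}$ from argument-independent levels to mere ground stratification yields an inconsistent logic.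
   Context: Terms are simply typed $\lambda$-terms modulo $\alpha\beta\eta$ over base types and $o$, with a signature containing $\bot,\top:o$, $\wedge,\vee,\supset:o\to o\to o$ and $\forall_\alpha,\exists_\alpha$ for first-order types $\alpha$; formulas are terms of type $o$; atomic formulas are $p\,\vec t$ with $p$ a predicate constant. Variable contexts $\mathcal X$ are finite sets of typed variables; ground means no free variables. A substitution $\theta:\mathcal Y\to\mathcal X$ assigns to each variable of $\mathcal X$ a term over $\mathcal Y$; $\mathrm{range}(\theta)$ is the smallest context containing the free variables of its terms. Definitions consist of fixed-point clauses $H\stackrel{\Delta}{=}_{\mathcal X}B$ and inductive clauses $H\stackrel{\mu}{=}_{\mathcal X}B$ ($H=p\,\vec t$ a higher-order pattern containing all variables of $\mathcal X$); each predicate is fixed-point or inductive with all its clauses of that kind. Levels: from an ordinal assignment to ground atoms, $\mathrm{lvl}(\bot)=\mathrm{lvl}(\top)=0$, $\wedge,\vee$ max, $\mathrm{lvl}(A\supset B)=\max(\mathrm{lvl}A+1,\mathrm{lvl}B)$, quantifiers supremum over ground instances. A definition is ground stratified if some assignment gives $\mathrm{lvl}(H\rho)\ge\mathrm{lvl}(B\rho)$ for all clauses and all grounding $\rho$. The logic $\text{LD}^{\mu}$ additionally requires that for inductive $p$ the level of $p\,\vec t$ not depend on $\vec t$ (this fails for the $\mathtt{odd}$ clause above). Fixed-point operator of inductive $p$ with clauses $p\,\vec t_i\stackrel{\mu}{=}_{\mathcal X_i}B_i$: $B=\lambda p.\lambda\vec x.\bigvee_i\exists\mathcal X_i.(\mathrm{eq}\,x_1\,t_i^1)\wedge\dots\wedge(\mathrm{eq}\,x_k\,t_i^k)\wedge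 B_i$ (for $\mathtt{odd}$ this is $\lambda p.\lambda x.\exists y.(\mathrm{eq}\,x\,(\mathtt s\,y))\wedge(p\,y\supset\bot)$). Write $\mathrm{defn}(H\stackrel{\Delta}{=}_{\mathcal X}B,A,\theta,B')$ if some $\rho$ satisfies $H\rho=A\theta$, $B'=B\rho$. Rules of $\text{LD}^{\mu}$ on sequents $\mathcal X;\Gamma\vdash C$: usual intuitionistic rules for $\bot,\top,\wedge,\vee,\supset$; $\forall\mathcal L$, $\exists\mathcal R$ instantiating with a term over $\mathcal X$; $\forall\mathcal R$, $\exists\mathcal L$ with fresh eigenvariable; contraction, weakening, axiom $\mathcal X;A\vdash A$ ($A$ atomic), multicut (from $\mathcal X;\Delta_i\vdash A_i$ and $\mathcal X;\Gamma,A_1,\dots,A_n\vdash C$ infer $\mathcal X;\Gamma,\Delta_1,\dots,\Delta_n\vdash C$); for fixed-point $A=p\,\vec t$: $\Delta\mathcal L$ infers $\mathcal Y;\Gamma,A\vdash C$ from all $\mathrm{range}(\theta);\Gamma\theta,B'\vdash C\theta$ with $\mathrm{defn}(\text{clause},A,\theta,B')$, and $\Delta\mathcal R$ infers $\mathcal Y;\Gamma\vdash A$ from $\mathcal Y;\Gamma\vdash B'$ with $\mathrm{defn}(\text{clause},A,\text{identity},B')$; for inductive $p$ with operator $B$: $\mu\mathcal R$ from $\mathcal X;\Gamma\vdash B\,p\,\vec t$ infer $\mathcal X;\Gamma\vdash p\,\vec t$; $\mu\mathcal L$ from $\vec x;B\,S\,\vec x\vdash S\,\vec x$ and $\mathcal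 X;\Gamma,S\,\vec t\vdash C$ infer $\mathcal X;\Gamma,p\,\vec t\vdash C$, $S$ any closed term of $p$'s type. -}

module Defs where

open import Data.Nat using (ℕ; zero; suc; _≤_)
open import Data.Fin using (Fin; zero; suc)
open import Data.List using (List; []; _∷_; _++_; map; concat)
open import Data.List.Relation.Binary.Permutation.Propositional using (_↭_)
open import Data.Vec.Functional using (toList)
open import Data.Product using (_×_)
open import Data.Empty using (⊥)
open import Data.Unit using (⊤)
open import Relation.Binary.PropositionalEquality using (_≡_)

-- Terms of type nat over a context of n nat-variables (de Bruijn).
-- Signature: z : nat, s : nat → nat.  (β-η-normal forms; α by de Bruijn.)

data Tm (n : ℕ) : Set where
  var : Fin n → Tm n
  z   : Tm n
  s   : Tm n → Tm n

-- A substitution θ : 𝒴 → 𝒳 assigns to each variable of 𝒳 (n of them)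
-- a term over 𝒴 (m variables).
Sub : ℕ → ℕ → Set
Sub m n = Fin n → Tm m

substT : ∀ {m n} → Sub m n → Tm n → Tm m
substT θ (var i) = θ i
substT θ z       = z
substT θ (s t)   = s (substT θ t)

wkT : ∀ {n} → Tm n → Tm (suc n)
wkT = substT (λ i → var (suc i))

lift : ∀ {m n} → Sub m n → Sub (suc m) (suc n)
lift θ zero    = var zero
lift θ (suc i) = wkT (θ i)

extend : ∀ {m n} → Tm m → Sub m n → Sub m (suc n)
extend t θ zero    = t
extend t θ (suc i) = θ i

data Atom (n : ℕ) : Set where
  eq  : Tm n → Tm n → Atom n
  ev  : Tm n → Atom n
  odd : Tm n → Atom n

data Fm (n : ℕ) : Set where
  atm        : Atom n → Fm n
  ⊥F ⊤F      : Fm n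
  _∧F_ _∨F_ _⊃F_ : Fm n → Fm n → Fm n
  ∀F ∃F      : Fm (suc n) → Fm n

substA : ∀ {m n} → Sub m n → Atom n → Atom m
substA θ (eq t u) = eq (substT θ t) (substT θ u)
substA θ (ev t)   = ev (substT θ t)
substA θ (odd t)  = odd (substT θ t)

substF : ∀ {m n} → Sub m n → Fm n → Fm m
substF θ (atm A)  = atm (substA θ A)
substF θ ⊥F       = ⊥F
substF θ ⊤F       = ⊤F
substF θ (A ∧F B) = substF θ A ∧F substF θ B
substF θ (A ∨F B) = substF θ A ∨F substF θ B
substF θ (A ⊃F B) = substF θ A ⊃F substF θ B
substF θ (∀F A)   = ∀F (substF (lift θ) A)
substF θ (∃F A)   = ∃F (substF (lift θ) A)

wkF : ∀ {n} → Fm n → Fm (suc n)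
wkF = substF (λ i → var (suc i))

inst : ∀ {n} → Fm (suc n) → Tm n → Fm n
inst F t = substF (extend t var) F

-- application S t of a closed predicate S = λx.F (F : Fm 1) to a term
app : ∀ {m} → Fm 1 → Tm m → Fm m
app S t = substF (λ _ → t) S

data FixClause : Set where
  eqC evzC evsC : FixClause

fArity : FixClause → ℕ
fArity eqC  = 1
fArity evzC = 0
fArity evsC = 1

fHead : (c : FixClause) → Atom (fArity c)
fHead eqC  = eq (var zero) (var zero)
fHead evzC = ev z
fHead evsC = ev (s (var zero))

fBody : (c : FixClause) → Fm (fArity c)
fBody eqC  = ⊤F
fBody evzC = ⊤F
fBody evsC = atm (ev (var zero)) ⊃F ⊥F

data Clause : Set where
  fix   : FixClause → Clause
  oddC  : Clause

arity : Clause → ℕ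
arity (fix c) = fArity c
arity oddC    = 1

head : (c : Clause) → Atom (arity c)
head (fix c) = fHead c
head oddC    = odd (s (var zero))

body : (c : Clause) → Fm (arity c)
body (fix c) = fBody c
body oddC    = atm (odd (var zero)) ⊃F ⊥F

oddOp : ∀ {n} → Fm 1 → Tm n → Fm n
oddOp S t = ∃F ((atm (eq (wkT t) (s (var zero)))) ∧F (app S (var zero) ⊃F ⊥F))

IsFixAtom : ∀ {n} → Atom n → Set
IsFixAtom (eq _ _) = ⊤
IsFixAtom (ev _)   = ⊤
IsFixAtom (odd _)  = ⊥

Assign : Set
Assign = Atom 0 → ℕ

-- Lvl≤ a F ρ n  :  lvl (F ρ) ≤ n,  for ρ a grounding substitution
Lvl≤ : ∀ {k} → Assign → Fm k → Sub 0 k → ℕ → Set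
Lvl≤ a (atm A)  ρ n       = a (substA ρ A) ≤ n
Lvl≤ a ⊥F       ρ n       = ⊤
Lvl≤ a ⊤F       ρ n       = ⊤
Lvl≤ a (A ∧F B) ρ n       = Lvl≤ a A ρ n × Lvl≤ a B ρ n
Lvl≤ a (A ∨F B) ρ n       = Lvl≤ a A ρ n × Lvl≤ a B ρ n
Lvl≤ a (A ⊃F B) ρ zero    = ⊥
Lvl≤ a (A ⊃F B) ρ (suc n) = Lvl≤ a A ρ n × Lvl≤ a B ρ (suc n)
Lvl≤ a (∀F A)   ρ n       = (t : Tm 0) → Lvl≤ a A (extend t ρ) n
Lvl≤ a (∃F A)   ρ n       = (t : Tm 0) → Lvl≤ a A (extend t ρ) n

GroundStratified : Assign → Set
GroundStratified a = (c : Clause) (ρ : Sub 0 (arity c)) →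
  Lvl≤ a (body c) ρ (a (substA ρ (head c)))

-- The sequent calculus LD^μ for 𝒟 (with the level side condition on
-- inductive predicates dropped: the rules never consult levels).
-- Der n Γ C :  𝒳 ; Γ ⊢ C  with 𝒳 = n nat-variables.

data Der : (n : ℕ) → List (Fm n) → Fm n → Set where
  ax   : ∀ {n} {A : Atom n} → Der n (atm A ∷ []) (atm A)
  ⊥L   : ∀ {n Γ C} → Der n (⊥F ∷ Γ) C
  ⊤R   : ∀ {n Γ} → Der n Γ ⊤F
  ∧L₁  : ∀ {n Γ A B C} → Der n (A ∷ Γ) C → Der n ((A ∧F B) ∷ Γ) C
  ∧L₂  : ∀ {n Γ A B C} → Der n (B ∷ Γ) C → Der n ((A ∧F B) ∷ Γ) C
  ∧R   : ∀ {n Γ A B} → Der n Γ A → Der n Γ B → Der n Γ (A ∧F B)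
  ∨L   : ∀ {n Γ A B C} → Der n (A ∷ Γ) C → Der n (B ∷ Γ) C → Der n ((A ∨F B) ∷ Γ) C
  ∨R₁  : ∀ {n Γ A B} → Der n Γ A → Der n Γ (A ∨F B)
  ∨R₂  : ∀ {n Γ A B} → Der n Γ B → Der n Γ (A ∨F B)
  ⊃L   : ∀ {n Γ A B C} → Der n Γ A → Der n (B ∷ Γ) C → Der n ((A ⊃F B) ∷ Γ) C
  ⊃R   : ∀ {n Γ A B} → Der n (A ∷ Γ) B → Der n Γ (A ⊃F B)
  ∀L   : ∀ {n Γ F C} (t : Tm n) → Der n (inst F t ∷ Γ) C → Der n (∀F F ∷ Γ) C
  ∀R   : ∀ {n Γ F} → Der (suc n) (map wkF Γ) F → Der n Γ (∀F F)
  ∃L   : ∀ {n Γ F C} → Der (suc n) (F ∷ map wkF Γ) (wkF C) → Der n (∃F F ∷ Γ) C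
  ∃R   : ∀ {n Γ F} (t : Tm n) → Der n Γ (inst F t) → Der n Γ (∃F F)
  cL   : ∀ {n Γ A C} → Der n (A ∷ A ∷ Γ) C → Der n (A ∷ Γ) C
  wL   : ∀ {n Γ A C} → Der n Γ C → Der n (A ∷ Γ) C
  exch : ∀ {n Γ Γ′ C} → Γ ↭ Γ′ → Der n Γ C → Der n Γ′ C
  mc   : ∀ {n Γ C} (k : ℕ) (Δ : Fin k → List (Fm n)) (As : Fin k → Fm n) →
         ((i : Fin k) → Der n (Δ i) (As i)) →
         Der n (Γ ++ toList As) C →
         Der n (Γ ++ concat (toList Δ)) C
  ΔL   : ∀ {n Γ C} {A : Atom n} → IsFixAtom A →
         ((c : FixClause) (m : ℕ) (θ : Sub m n) (ρ : Sub m (fArity c)) →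
           substA ρ (fHead c) ≡ substA θ A →
           Der m (substF ρ (fBody c) ∷ map (substF θ) Γ) (substF θ C)) →
         Der n (atm A ∷ Γ) C
  ΔR   : ∀ {n Γ} (c : FixClause) (ρ : Sub n (fArity c)) →
         Der n Γ (substF ρ (fBody c)) → Der n Γ (atm (substA ρ (fHead c)))
  μR   : ∀ {n Γ} {t : Tm n} → Der n Γ (oddOp (atm (odd (var zero))) t) → Der n Γ (atm (odd t))
  μL   : ∀ {n Γ C} {t : Tm n} (S : Fm 1) →
         Der 1 (oddOp S (var zero) ∷ []) (app S (var zero)) →
         Der n (app S t ∷ Γ) C →
         Der n (atm (odd t) ∷ Γ) C

{-# OPTIONS --safe #-}
-- Levels by numeral size stratify 𝒟, but they let the level of odd t grow with t, and then
-- odd may occur negatively in its own clause.  Induction on odd with the invariant "is a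
-- successor" refutes odd z, so μR proves odd (s z).  Induction with the invariant ev, which
-- unfolds to exactly the same clause, shows that odd t entails ev t; and ev (s z) unfolds to
-- ¬ ev z, which is refuted by ev z ≜ ⊤.  A cut on odd (s z) closes ⊢ ⊥.
module Submission where

open import Defs
open import Data.Product using (Σ; _×_; _,_)
open import Data.List using ([]; _∷_; map)
open import Data.List.Relation.Binary.Permutation.Propositional using (swap; refl)
open import Data.Nat using (ℕ; suc)
open import Data.Nat.Properties using (≤-refl)
open import Data.Fin using (zero; suc)
open import Data.Unit using (tt)
open import Data.Empty using (⊥-elim)
open import Relation.Binary.PropositionalEquality
  using (_≡_; _≢_; refl; sym; cong)

size : ∀ {n} → Tm n → ℕ
size (var _) = 0
size z       = 0
size (s t)   = suc (size t)

sizeLevel : Assign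
sizeLevel (eq _ _) = 0
sizeLevel (ev t)   = size t
sizeLevel (odd t)  = size t

sizeLevel-groundStratified : GroundStratified sizeLevel
sizeLevel-groundStratified (fix eqC)  ρ = tt
sizeLevel-groundStratified (fix evzC) ρ = tt
sizeLevel-groundStratified (fix evsC) ρ = ≤-refl , tt
sizeLevel-groundStratified oddC       ρ = ≤-refl , tt

substT-extend-wkT : ∀ {n} (u t : Tm n) → substT (extend u var) (wkT t) ≡ t
substT-extend-wkT u (var i) = refl
substT-extend-wkT u z       = refl
substT-extend-wkT u (s t)   = cong s (substT-extend-wkT u t)

eq-head-match : ∀ {n} {u v w : Tm n} → eq u u ≡ eq v w → v ≡ w
eq-head-match refl = refl

ev-head-match : ∀ {n} {u v : Tm n} → ev u ≡ ev v → u ≡ v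
ev-head-match refl = refl

s-injective : ∀ {n} {u v : Tm n} → s u ≡ s v → u ≡ v
s-injective refl = refl

z≢s : ∀ {n} {u : Tm n} → z ≢ s u
z≢s ()

¬atm-refl : ∀ {n} {A : Atom n} → Der n ((atm A ⊃F ⊥F) ∷ []) (atm A ⊃F ⊥F)
¬atm-refl = ⊃R (exch (swap _ _ refl) (⊃L ax ⊥L))

odd-intro : ∀ {n Γ} {t : Tm n} → Der n Γ (atm (odd t) ⊃F ⊥F) → Der n Γ (atm (odd (s t)))
odd-intro {n} {Γ} {t} ¬odd = μR (∃R t (∧R eq-premise ¬odd))
  where
  eq-premise : Der n Γ (atm (eq (s (substT (extend t var) (wkT t))) (s t)))
  eq-premise rewrite substT-extend-wkT t t = ΔR eqC (λ _ → s t) ⊤R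

isSucc : Fm 1
isSucc = ∃F (atm (eq (var (suc zero)) (s (var zero))))

isSucc-prefixed : Der 1 (oddOp isSucc (var zero) ∷ []) (app isSucc (var zero))
isSucc-prefixed = ∃L (∧L₁ (∃R (var zero) ax))

odd-zero-elim : ∀ {n Γ C} → Der n (atm (odd z) ∷ Γ) C
odd-zero-elim = μL isSucc isSucc-prefixed (∃L (ΔL tt z≡s-clauses))
  where
  z≡s-clauses : ∀ {n Γ C} (c : FixClause) (m : ℕ) (θ : Sub m (suc n)) (ρ : Sub m (fArity c)) →
    substA ρ (fHead c) ≡ eq z (s (θ zero)) →
    Der m (substF ρ (fBody c) ∷ map (substF θ) Γ) (substF θ C)
  z≡s-clauses eqC m θ ρ e = ⊥-elim (z≢s (eq-head-match e))
  z≡s-clauses evzC m θ ρ ()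
  z≡s-clauses evsC m θ ρ ()

ev-intro : ∀ {n Γ} {t : Tm n} → Der n Γ (atm (ev t) ⊃F ⊥F) → Der n Γ (atm (ev (s t)))
ev-intro {t = t} = ΔR evsC (λ _ → t)

ev-subst : ∀ {n Γ} {u v : Tm n} → u ≡ v → Der n Γ (atm (ev u)) → Der n Γ (atm (ev v))
ev-subst refl d = d

isEv : Fm 1
isEv = atm (ev (var zero))

isEv-prefixed : Der 1 (oddOp isEv (var zero) ∷ []) (app isEv (var zero))
isEv-prefixed = ∃L (cL (∧L₁ (ΔL tt ev-clauses)))
  where
  ev-clauses : (c : FixClause) (m : ℕ) (θ : Sub m 2) (ρ : Sub m (fArity c)) →
    substA ρ (fHead c) ≡ eq (θ (suc zero)) (s (θ zero)) →
    Der m (substF ρ (fBody c) ∷ (atm (eq (θ (suc zero)) (s (θ zero))) ∧F (atm (ev (θ zero)) ⊃F ⊥F)) ∷ [])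
          (atm (ev (θ (suc zero))))
  ev-clauses eqC m θ ρ e =
    wL (∧L₂ (ev-subst (sym (eq-head-match e)) (ev-intro ¬atm-refl)))
  ev-clauses evzC m θ ρ ()
  ev-clauses evsC m θ ρ ()

odd⇒ev : ∀ {n Γ C} {t : Tm n} → Der n (atm (ev t) ∷ Γ) C → Der n (atm (odd t) ∷ Γ) C
odd⇒ev = μL isEv isEv-prefixed

ev-one-elim : ∀ {n Γ C} → Der n (atm (ev (s z)) ∷ Γ) C
ev-one-elim = ΔL tt ev-one-clauses
  where
  ev-one-clauses : ∀ {n Γ C} (c : FixClause) (m : ℕ) (θ : Sub m n) (ρ : Sub m (fArity c)) →
    substA ρ (fHead c) ≡ ev (s z) → Der m (substF ρ (fBody c) ∷ map (substF θ) Γ) (substF θ C)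
  ev-one-clauses eqC  m θ ρ ()
  ev-one-clauses evzC m θ ρ ()
  ev-one-clauses evsC m θ ρ e =
    ⊃L (ev-subst (sym (s-injective (ev-head-match e))) (ΔR evzC (λ ()) ⊤R)) ⊥L

odd-one : Der 0 [] (atm (odd (s z)))
odd-one = odd-intro (⊃R odd-zero-elim)

inconsistent : Der 0 [] ⊥F
inconsistent =
  mc {Γ = []} 1 (λ _ → []) (λ _ → atm (odd (s z))) (λ _ → odd-one) (odd⇒ev ev-one-elim)

mainTheorem7 : (Σ Assign λ a → GroundStratified a ×
                  Σ (Tm 0) λ t → Σ (Tm 0) λ u → a (odd t) ≢ a (odd u))
               × Der 0 [] ⊥F
mainTheorem7 = (sizeLevel , sizeLevel-groundStratified , z , s z , λ ()) , inconsistent
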